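{- Let $G$ be a finite pure bicoloured graph. Then every $H\in[G]$ is pure and the set of critical vertices of $H$ equals the set of critical vertices of $G$.
   Context: Bicoloured local complementation: $Gx$ has edge set $E(G)\triangle\{[y,z]:y\ne z\in N_G(x)\}$, same colours if $x$ is black, colours of $N_G(x)$ reversed if $x$ is white; $Gx_1\cdots x_k=(\cdots(Gx_1)\cdots)x_k$. $W^\circ(G)$ is the smallest set of words containing the empty word with: $s\in W^\circ(G)$, $x$ white in $Gs$ $\Rightarrow sx\in W^\circ(G)$; $s\in W^\circ(G)$, $x,y$ adjacent black in $Gs$ $\Rightarrow sxyx,syxy\in W^\circ(G)$. $[G]=\{Gs:s\in W^\circ(G)\}$; $G$ is pure if no member of $[G]$ has a maximal independent set consisting only of black vertices. For $u\in V(G)$ let $(G',u)$ be the rooted graph keeping colours on $V(G)\setminus\{u\}$ and forgetting the colour of $u$; the root graphs induced by $u$ are $rw(G')$ ($u$ white), $rb(G')$ ($u$ black) and $rc(G')$ (colour $u$ white, locally complement at $u$, recolour $u$ black). A vertex $u$ of a pure graph is critical if some root graph induced by $u$ is not pure. -}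

module Defs where

open import Data.Nat using (ℕ)
open import Data.Fin using (Fin; _≟_)
open import Data.Bool using (Bool; true; false; not; _∧_; _xor_; if_then_else_)
open import Data.List using (List; []; _∷_; _++_; foldl)
open import Data.Product using (Σ; _×_; _,_)
open import Data.Sum using (_⊎_)
open import Relation.Nullary using (¬_)
open import Relation.Nullary.Decidable using (⌊_⌋)
open import Relation.Binary.PropositionalEquality using (_≡_)

data Colour : Set where
  black white : Colour

record BGraph (n : ℕ) : Set where
  constructor mkBGraph
  field
    adj    : Fin n → Fin n → Bool
    colour : Fin n → Colour
open BGraph public

record WF {n : ℕ} (G : BGraph n) : Set where
  field
    adj-sym : ∀ x y → adj G x y ≡ adj G y x
    adj-irr : ∀ x → adj G x x ≡ false

flip : Colour → Colour
flip black = white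
flip white = black

_≠ᵇ_ : {n : ℕ} → Fin n → Fin n → Bool
y ≠ᵇ z = not ⌊ y ≟ z ⌋

lc : {n : ℕ} → BGraph n → Fin n → BGraph n
lc G x = mkBGraph newAdj newCol
  where
  newAdj : _ → _ → Bool
  newAdj y z = adj G y z xor ((y ≠ᵇ z) ∧ (adj G x y ∧ adj G x z))
  newCol : _ → Colour
  newCol y with colour G x
  ... | black = colour G y
  ... | white = if adj G x y then flip (colour G y) else colour G y

_⋆_ : {n : ℕ} → BGraph n → List (Fin n) → BGraph n
G ⋆ s = foldl lc G s

data W° {n : ℕ} (G : BGraph n) : List (Fin n) → Set where
  w-empty : W° G []
  w-white : ∀ {s x} → W° G s → colour (G ⋆ s) x ≡ white → W° G (s ++ x ∷ [])
  w-xyx   : ∀ {s x y} → W° G s → colour (G ⋆ s) x ≡ black → colour (G ⋆ s) y ≡ black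
          → adj (G ⋆ s) x y ≡ true → W° G (s ++ x ∷ y ∷ x ∷ [])
  w-yxy   : ∀ {s x y} → W° G s → colour (G ⋆ s) x ≡ black → colour (G ⋆ s) y ≡ black
          → adj (G ⋆ s) x y ≡ true → W° G (s ++ y ∷ x ∷ y ∷ [])

Subset : ℕ → Set
Subset n = Fin n → Bool

_⊆_ : {n : ℕ} → Subset n → Subset n → Set
S ⊆ T = ∀ v → S v ≡ true → T v ≡ true

Independent : {n : ℕ} → BGraph n → Subset n → Set
Independent G S = ∀ y z → S y ≡ true → S z ≡ true → adj G y z ≡ false

MaximalIndependent : {n : ℕ} → BGraph n → Subset n → Set
MaximalIndependent G S =
  Independent G S × (∀ T → Independent G T → S ⊆ T → T ⊆ S)

AllBlack : {n : ℕ} → BGraph n → Subset n → Set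
AllBlack G S = ∀ v → S v ≡ true → colour G v ≡ black

-- G is pure: no member G s (s ∈ W°(G)) of [G] has a maximal independent
-- set consisting only of black vertices.
Pure : {n : ℕ} → BGraph n → Set
Pure {n} G = ∀ s → W° G s →
  ¬ (Σ (Subset n) λ S → MaximalIndependent (G ⋆ s) S × AllBlack (G ⋆ s) S)

setColour : {n : ℕ} → BGraph n → Fin n → Colour → BGraph n
setColour G u c = mkBGraph (adj G) newCol
  where
  newCol : _ → Colour
  newCol y = if ⌊ y ≟ u ⌋ then c else colour G y

rw rb rc : {n : ℕ} → BGraph n → Fin n → BGraph n
rw G u = setColour G u white
rb G u = setColour G u black
rc G u = setColour (lc (setColour G u white) u) u black

-- u is critical: some root graph induced by u is not pure.
-- (Only meaningful for pure G, as in the paper.)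
Critical : {n : ℕ} → BGraph n → Fin n → Set
Critical G u = ¬ Pure (rw G u) ⊎ (¬ Pure (rb G u) ⊎ ¬ Pure (rc G u))

-- A member H = G s of [G] is reached by a word s ∈ W°(G), and every word of W°(H) extends s
-- to a word of W°(G); hence [H] ⊆ [G] and H is pure.  For the critical vertices it suffices to
-- treat one white local complementation G x and one pivot G xyx.  For each root graph R of
-- the new graph at a vertex u we exhibit a root graph R′ of the old graph at u and a word
-- w ∈ W°(R′) with R′ w = R; so if R is not pure, neither is R′.  Since both kinds of step are
-- involutions whose inverse is again an admissible step, criticality is preserved in both
-- directions.  The required identities between local complementations and recolourings involve
-- at most three named vertices, and the adjacency (colour) of a pair (vertex) after such a
-- sequence only depends on the subgraph induced by the named vertices and that pair (vertex).
-- So each identity is decided by evaluating it on all bicoloured graphs with at most five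
-- vertices.
module Submission where

open import Defs
open import Data.Bool using (Bool; true; false; not; _∧_; _∨_; _xor_; if_then_else_; T)
open import Data.Bool.Properties using (∧-comm; T-∧) renaming (_≟_ to _≟ᵇ_)
open import Data.Bool.ListAction using (all)
open import Data.Empty using (⊥-elim)
open import Data.Fin using (Fin; zero; suc; _≟_; _↑ʳ_)
open import Data.Fin.Patterns using (0F; 1F; 2F)
open import Data.Fin.Properties using (any?)
open import Data.List using (List; []; _∷_; _++_; foldl; allFin; [_])
open import Data.List.Properties using (++-assoc; ++-identityʳ; foldl-++)
open import Data.List.Membership.Propositional using (_∈_)
open import Data.List.Membership.Propositional.Properties using (∈-allFin)
open import Data.List.Relation.Unary.Any using (here; there)
open import Data.List.Relation.Unary.All as All using (All; []; _∷_)
open import Data.List.Relation.Unary.All.Properties using (all⁺; all⁻)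
open import Data.Nat using (ℕ; zero; suc)
open import Data.Product using (∃; _×_; _,_; proj₁; proj₂; uncurry)
open import Data.Sum using (inj₁; inj₂)
open import Data.Unit using (⊤; tt)
open import Data.Vec using (Vec; []; _∷_; lookup; tabulate)
open import Data.Vec.Properties using (lookup∘tabulate)
open import Data.Vec.Functional using () renaming ([] to ∅; _∷_ to _◂_)
open import Function using (_∘_; id; case_of_)
open import Function.Bundles using (_⇔_; mk⇔; Equivalence)
open import Function.Construct.Composition using (_⇔-∘_)
open import Function.Construct.Identity using (⇔-id)
open import Function.Definitions using (Injective)
open import Relation.Binary.Definitions using (DecidableEquality)
open import Relation.Binary.PropositionalEquality
  using (_≡_; _≢_; refl; sym; trans; cong; cong₂; subst; ≢-sym; module ≡-Reasoning)
open import Relation.Nullary using (¬_; yes; no)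
open import Relation.Nullary.Decidable using (⌊_⌋; toWitness; fromWitness)

private
  variable
    k m n : ℕ
    G H K : BGraph n

infix 4 _≅ᵃ_ _≅_

_≅ᵃ_ : BGraph n → BGraph n → Set
G ≅ᵃ H = ∀ i j → adj G i j ≡ adj H i j

record _≅_ (G H : BGraph n) : Set where
  constructor mk≅
  field
    adj≡    : G ≅ᵃ H
    colour≡ : ∀ i → colour G i ≡ colour H i
open _≅_

≅-refl : G ≅ G
≅-refl = mk≅ (λ _ _ → refl) (λ _ → refl)

≅-sym : G ≅ H → H ≅ G
≅-sym p = mk≅ (λ i j → sym (adj≡ p i j)) (λ i → sym (colour≡ p i))

≅-trans : G ≅ H → H ≅ K → G ≅ K
≅-trans p q = mk≅ (λ i j → trans (adj≡ p i j) (adj≡ q i j)) (λ i → trans (colour≡ p i) (colour≡ q i))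

lcColour : Colour → Bool → Colour → Colour
lcColour black _ c = c
lcColour white a c = if a then flip c else c

colour-lc : (G : BGraph n) (x y : Fin n) → colour (lc G x) y ≡ lcColour (colour G x) (adj G x y) (colour G y)
colour-lc G x y with colour G x
... | black = refl
... | white = refl

lc-congᵃ : ∀ x → G ≅ᵃ H → lc G x ≅ᵃ lc H x
lc-congᵃ x p i j rewrite p i j | p x i | p x j = refl

lc-cong : ∀ x → G ≅ H → lc G x ≅ lc H x
lc-cong {G = G} {H = H} x p = mk≅ (lc-congᵃ {G = G} {H} x (adj≡ p)) λ i → begin
  colour (lc G x) i                                ≡⟨ colour-lc G x i ⟩
  lcColour (colour G x) (adj G x i) (colour G i)   ≡⟨ cong₂ (λ c d → lcColour c (adj G x i) d)
                                                               (colour≡ p x) (colour≡ p i) ⟩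
  lcColour (colour H x) (adj G x i) (colour H i)   ≡⟨ cong (λ a → lcColour (colour H x) a (colour H i))
                                                              (adj≡ p x i) ⟩
  lcColour (colour H x) (adj H x i) (colour H i)   ≡⟨ colour-lc H x i ⟨
  colour (lc H x) i                                ∎
  where open ≡-Reasoning

setColour-cong : ∀ u c → G ≅ H → setColour G u c ≅ setColour H u c
setColour-cong u c p = mk≅ (adj≡ p) λ i → cong (if ⌊ i ≟ u ⌋ then c else_) (colour≡ p i)

⋆-cong : ∀ s → G ≅ H → G ⋆ s ≅ H ⋆ s
⋆-cong []      p = p
⋆-cong (x ∷ s) p = ⋆-cong s (lc-cong x p)

⋆-++ : ∀ (G : BGraph n) s t → G ⋆ (s ++ t) ≡ (G ⋆ s) ⋆ t
⋆-++ = foldl-++ lc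

≠ᵇ-sym : (y z : Fin n) → (y ≠ᵇ z) ≡ (z ≠ᵇ y)
≠ᵇ-sym y z with y ≟ z | z ≟ y
... | yes _   | yes _   = refl
... | no _    | no _    = refl
... | yes y≡z | no z≢y  = ⊥-elim (z≢y (sym y≡z))
... | no y≢z  | yes z≡y = ⊥-elim (y≢z (sym z≡y))

≠ᵇ-irrefl : (y : Fin n) → (y ≠ᵇ y) ≡ false
≠ᵇ-irrefl y with y ≟ y
... | yes _  = refl
... | no y≢y = ⊥-elim (y≢y refl)

lc-WF : ∀ x → WF G → WF (lc G x)
lc-WF {G = G} x wf = record
  { adj-sym = λ y z → cong₂ _xor_ (WF.adj-sym wf y z)
                        (cong₂ _∧_ (≠ᵇ-sym y z) (∧-comm (adj G x y) (adj G x z)))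
  ; adj-irr = λ y → cong₂ _xor_ (WF.adj-irr wf y) (cong (_∧ _) (≠ᵇ-irrefl y))
  }

⋆-WF : ∀ s → WF G → WF (G ⋆ s)
⋆-WF []      wf = wf
⋆-WF (x ∷ s) wf = ⋆-WF s (lc-WF x wf)

adj⇒≢ : WF G → ∀ {x y} → adj G x y ≡ true → x ≢ y
adj⇒≢ wf {x} xy refl with trans (sym xy) (WF.adj-irr wf x)
... | ()

-- Admissible words and purity

W°-resp-≅ : ∀ {s} → G ≅ H → W° G s → W° H s
W°-resp-≅ p w-empty               = w-empty
W°-resp-≅ p (w-white {s} d c)      = w-white (W°-resp-≅ p d) (trans (sym (colour≡ (⋆-cong s p) _)) c)
W°-resp-≅ p (w-xyx {s} d cx cy a) =
  w-xyx (W°-resp-≅ p d) (trans (sym (colour≡ (⋆-cong s p) _)) cx)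
        (trans (sym (colour≡ (⋆-cong s p) _)) cy) (trans (sym (adj≡ (⋆-cong s p) _ _)) a)
W°-resp-≅ p (w-yxy {s} d cx cy a) =
  w-yxy (W°-resp-≅ p d) (trans (sym (colour≡ (⋆-cong s p) _)) cx)
        (trans (sym (colour≡ (⋆-cong s p) _)) cy) (trans (sym (adj≡ (⋆-cong s p) _ _)) a)

W°-++ : ∀ {s t} → W° G s → W° (G ⋆ s) t → W° G (s ++ t)
W°-++ {s = s} d w-empty = subst (W° _) (sym (++-identityʳ s)) d
W°-++ {G = G} {s = s} d (w-white {t} {x} e c) =
  subst (W° G) (++-assoc s t _) (w-white (W°-++ d e) (subst (λ K → colour K x ≡ white) (sym (⋆-++ G s t)) c))
W°-++ {G = G} {s = s} d (w-xyx {t} {x} {y} e cx cy a) =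
  subst (W° G) (++-assoc s t _) (w-xyx (W°-++ d e)
    (subst (λ K → colour K x ≡ black) (sym (⋆-++ G s t)) cx)
    (subst (λ K → colour K y ≡ black) (sym (⋆-++ G s t)) cy)
    (subst (λ K → adj K x y ≡ true) (sym (⋆-++ G s t)) a))
W°-++ {G = G} {s = s} d (w-yxy {t} {x} {y} e cx cy a) =
  subst (W° G) (++-assoc s t _) (w-yxy (W°-++ d e)
    (subst (λ K → colour K x ≡ black) (sym (⋆-++ G s t)) cx)
    (subst (λ K → colour K y ≡ black) (sym (⋆-++ G s t)) cy)
    (subst (λ K → adj K x y ≡ true) (sym (⋆-++ G s t)) a))

pure-⋆ : ∀ {s} → Pure G → W° G s → Pure (G ⋆ s)
pure-⋆ {G = G} {s} pure d t e (S , maximal , allBlack) =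
  pure (s ++ t) (W°-++ d e)
    (S , subst (λ K → MaximalIndependent K S × AllBlack K S) (sym (⋆-++ G s t)) (maximal , allBlack))

pure-resp-≅ : G ≅ H → Pure G → Pure H
pure-resp-≅ {G = G} {H = H} p pure t e (S , (independent , maximal) , allBlack) =
  pure t (W°-resp-≅ (≅-sym p) e) (S , (independent′ , maximal′) , black′)
  where
  q : G ⋆ t ≅ H ⋆ t
  q = ⋆-cong t p
  independent′ : Independent (G ⋆ t) S
  independent′ y z Sy Sz = trans (adj≡ q y z) (independent y z Sy Sz)
  maximal′ : ∀ T → Independent (G ⋆ t) T → S ⊆ T → T ⊆ S
  maximal′ T indep = maximal T (λ y z Ty Tz → trans (sym (adj≡ q y z)) (indep y z Ty Tz))
  black′ : AllBlack (G ⋆ t) S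
  black′ v Sv = trans (colour≡ q v) (allBlack v Sv)

infix 4 _↝_

record _↝_ (H H′ : BGraph n) : Set where
  constructor via
  field
    word       : List (Fin n)
    admissible : W° H word
    reaches    : H ⋆ word ≅ H′

↝-¬pure : H ↝ K → ¬ Pure K → ¬ Pure H
↝-¬pure (via _ d e) ¬pure pure = ¬pure (pure-resp-≅ e (pure-⋆ pure d))

data Root : Set where
  W B C : Root

root : Root → BGraph n → Fin n → BGraph n
root W = rw
root B = rb
root C = rc

root-cong : ∀ r u → G ≅ H → root r G u ≅ root r H u
root-cong W u p = setColour-cong u white p
root-cong B u p = setColour-cong u black p
root-cong C u p = setColour-cong u black (lc-cong u (setColour-cong u white p))

critical⇒ : ∀ {u} → Critical G u → ∃ λ r → ¬ Pure (root r G u)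
critical⇒ (inj₁ ¬pure)        = W , ¬pure
critical⇒ (inj₂ (inj₁ ¬pure)) = B , ¬pure
critical⇒ (inj₂ (inj₂ ¬pure)) = C , ¬pure

⇒critical : ∀ {u} r → ¬ Pure (root r G u) → Critical G u
⇒critical W ¬pure = inj₁ ¬pure
⇒critical B ¬pure = inj₂ (inj₁ ¬pure)
⇒critical C ¬pure = inj₂ (inj₂ ¬pure)

critical-reflect : ∀ {u} → (∀ r → ∃ λ r′ → root r′ H u ↝ root r K u) → Critical K u → Critical H u
critical-reflect reduce critical =
  let r , ¬pure = critical⇒ critical
      r′ , H↝K  = reduce r
  in ⇒critical r′ (↝-¬pure H↝K ¬pure)

critical-resp-≅ : ∀ {u} → G ≅ H → Critical G u → Critical H u
critical-resp-≅ {u = u} p = critical-reflect λ r → r , via [] w-empty (root-cong r u (≅-sym p))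

-- Deciding identities between local operations on small graphs

data Op (m : ℕ) : Set where
  loc   : Fin m → Op m
  paint : Fin m → Colour → Op m

apply : (Fin m → Fin n) → BGraph n → Op m → BGraph n
apply ρ G (loc i)     = lc G (ρ i)
apply ρ G (paint i c) = setColour G (ρ i) c

⟦_⟧ : List (Op m) → BGraph n → (Fin m → Fin n) → BGraph n
⟦ e ⟧ G ρ = foldl (apply ρ) G e

apply-cong : ∀ (ρ : Fin m → Fin n) o → G ≅ H → apply ρ G o ≅ apply ρ H o
apply-cong ρ (loc i)     = lc-cong (ρ i)
apply-cong ρ (paint i c) = setColour-cong (ρ i) c

⟦⟧-congᵃ : ∀ e {ρ : Fin m → Fin n} → G ≅ᵃ H → ⟦ e ⟧ G ρ ≅ᵃ ⟦ e ⟧ H ρ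
⟦⟧-congᵃ []                            p = p
⟦⟧-congᵃ {G = G} {H} (loc i ∷ e) {ρ}   p = ⟦⟧-congᵃ e (lc-congᵃ {G = G} {H} (ρ i) p)
⟦⟧-congᵃ (paint i c ∷ e)               p = ⟦⟧-congᵃ e p

fromTables : Vec (Vec Bool k) k → Vec Colour k → BGraph k
fromTables A c = mkBGraph (λ i j → lookup (lookup A i) j) (lookup c)

tabulated : BGraph k → BGraph k
tabulated G = fromTables (tabulate (tabulate ∘ adj G)) (tabulate (colour G))

tabulated≅ : (G : BGraph k) → tabulated G ≅ G
tabulated≅ G = mk≅ (λ i j → trans (cong (λ row → lookup row j) (lookup∘tabulate _ i)) (lookup∘tabulate _ j))
                   (lookup∘tabulate _)

-- ⟦_⟧ with every intermediate graph stored as a table, so that normalising it (as the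
-- verification of rules below does) never recomputes earlier graphs.
⟦_⟧ₜ : List (Op m) → BGraph k → (Fin m → Fin k) → BGraph k
⟦ e ⟧ₜ G ρ = foldl (λ H o → tabulated (apply ρ H o)) G e

⟦⟧ₜ≅⟦⟧ : ∀ e {ρ : Fin m → Fin k} {G H : BGraph k} → G ≅ H → ⟦ e ⟧ₜ G ρ ≅ ⟦ e ⟧ H ρ
⟦⟧ₜ≅⟦⟧ []      p = p
⟦⟧ₜ≅⟦⟧ (o ∷ e) p = ⟦⟧ₜ≅⟦⟧ e (≅-trans (tabulated≅ _) (apply-cong _ o p))

restrict : BGraph n → (Fin k → Fin n) → BGraph k
restrict G σ = mkBGraph (λ i j → adj G (σ i) (σ j)) (colour G ∘ σ)

module _ {σ : Fin k → Fin n} (σ-inj : Injective _≡_ _≡_ σ) where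

  ≟-injective : ∀ a b → ⌊ σ a ≟ σ b ⌋ ≡ ⌊ a ≟ b ⌋
  ≟-injective a b with a ≟ b | σ a ≟ σ b
  ... | yes refl | yes _     = refl
  ... | yes refl | no σa≢σa  = ⊥-elim (σa≢σa refl)
  ... | no a≢b   | yes σa≡σb = ⊥-elim (a≢b (σ-inj σa≡σb))
  ... | no _     | no _      = refl

  restrict-apply : ∀ {ι : Fin m → Fin k} o → apply ι (restrict G σ) o ≅ restrict (apply (σ ∘ ι) G o) σ
  restrict-apply {G = G} {ι = ι} (loc i) = mk≅
    (λ a b → cong (λ d → adj G (σ a) (σ b) xor (d ∧ (adj G (σ (ι i)) (σ a) ∧ adj G (σ (ι i)) (σ b))))
                  (cong not (sym (≟-injective a b))))
    (λ a → trans (colour-lc (restrict G σ) (ι i) a) (sym (colour-lc G (σ (ι i)) (σ a))))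
  restrict-apply {G = G} {ι = ι} (paint i c) = mk≅ (λ _ _ → refl)
    (λ a → cong (λ d → if d then c else colour G (σ a)) (sym (≟-injective a (ι i))))

  restrict-⟦⟧ : ∀ e {ι : Fin m → Fin k} {M : BGraph k} →
    M ≅ restrict G σ → ⟦ e ⟧ M ι ≅ restrict (⟦ e ⟧ G (σ ∘ ι)) σ
  restrict-⟦⟧ []      p = p
  restrict-⟦⟧ (o ∷ e) p = restrict-⟦⟧ e (≅-trans (apply-cong _ o p) (restrict-apply o))

data Atom (m : ℕ) : Set where
  colourAt : List (Op m) → Fin m → Colour → Atom m
  adjAt    : List (Op m) → Fin m → Fin m → Bool → Atom m

Holds : BGraph n → (Fin m → Fin n) → Atom m → Set
Holds G ρ (colourAt e i c) = colour (⟦ e ⟧ G ρ) (ρ i) ≡ c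
Holds G ρ (adjAt e i j b)  = adj (⟦ e ⟧ G ρ) (ρ i) (ρ j) ≡ b

_≟ᶜ_ : DecidableEquality Colour
black ≟ᶜ black = yes refl
black ≟ᶜ white = no λ ()
white ≟ᶜ black = no λ ()
white ≟ᶜ white = yes refl

holds? : BGraph k → (Fin m → Fin k) → Atom m → Bool
holds? M ι (colourAt e i c) = ⌊ colour (⟦ e ⟧ₜ M ι) (ι i) ≟ᶜ c ⌋
holds? M ι (adjAt e i j b)  = ⌊ adj (⟦ e ⟧ₜ M ι) (ι i) (ι j) ≟ᵇ b ⌋

holds?-sound : ∀ (M : BGraph k) (ι : Fin m → Fin k) a → T (holds? M ι a) → Holds M ι a
holds?-sound M ι (colourAt e i c) t = trans (sym (colour≡ (⟦⟧ₜ≅⟦⟧ e ≅-refl) (ι i))) (toWitness t)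
holds?-sound M ι (adjAt e i j b)  t = trans (sym (adj≡ (⟦⟧ₜ≅⟦⟧ e ≅-refl) (ι i) (ι j))) (toWitness t)

holds?-complete : ∀ (M : BGraph k) (ι : Fin m → Fin k) a → Holds M ι a → T (holds? M ι a)
holds?-complete M ι (colourAt e i c) h = fromWitness (trans (colour≡ (⟦⟧ₜ≅⟦⟧ e ≅-refl) (ι i)) h)
holds?-complete M ι (adjAt e i j b)  h = fromWitness (trans (adj≡ (⟦⟧ₜ≅⟦⟧ e ≅-refl) (ι i) (ι j)) h)

Holds-restrict : {σ : Fin k → Fin n} → Injective _≡_ _≡_ σ → ∀ {ι : Fin m → Fin k} {M} a →
  M ≅ restrict G σ → Holds M ι a ⇔ Holds G (σ ∘ ι) a
Holds-restrict σ-inj {ι} (colourAt e i c) p = mk⇔ (trans (sym q)) (trans q)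
  where q = colour≡ (restrict-⟦⟧ σ-inj e p) (ι i)
Holds-restrict σ-inj {ι} (adjAt e i j b) p = mk⇔ (trans (sym q)) (trans q)
  where q = adj≡ (restrict-⟦⟧ σ-inj e p) (ι i) (ι j)

record Mask (k : ℕ) : Set where
  field
    pairs    : Fin k → Fin k → Bool
    vertices : Fin k → Bool
open Mask

Agree : Mask k → BGraph k → BGraph k → Set
Agree μ X Y = (∀ i j → T (pairs μ i j) → adj X i j ≡ adj Y i j)
            × (∀ i → T (vertices μ i) → colour X i ≡ colour Y i)

agree? : Mask k → BGraph k → BGraph k → Bool
agree? {k} μ X Y =
  all (λ i → all (λ j → if pairs μ i j then ⌊ adj X i j ≟ᵇ adj Y i j ⌋ else true) (allFin k)) (allFin k)
  ∧ all (λ i → if vertices μ i then ⌊ colour X i ≟ᶜ colour Y i ⌋ else true) (allFin k)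

T-allFin : ∀ {p : Fin k → Bool} → T (all p (allFin k)) → ∀ i → T (p i)
T-allFin {p = p} t i = All.lookup (all⁺ p _ t) (∈-allFin i)

T-if : ∀ {b c} → T (if b then c else true) → T b → T c
T-if {true} t _ = t

agree?-sound : ∀ (μ : Mask k) X Y → T (agree? μ X Y) → Agree μ X Y
agree?-sound μ X Y t =
  (λ i j m → toWitness (T-if (T-allFin (T-allFin (proj₁ t′) i) j) m)) ,
  (λ i m → toWitness (T-if (T-allFin (proj₂ t′) i) m))
  where t′ = Equivalence.to T-∧ t

Agree-resp-≅ : ∀ (μ : Mask k) {X X′ Y Y′} → X ≅ X′ → Y ≅ Y′ → Agree μ X Y → Agree μ X′ Y′
Agree-resp-≅ μ p q (adjacent , coloured) =
  (λ i j m → trans (sym (adj≡ p i j)) (trans (adjacent i j m) (adj≡ q i j))) ,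
  (λ i m → trans (sym (colour≡ p i)) (trans (coloured i m) (colour≡ q i)))

Equation : ℕ → Set
Equation m = List (Op m) × List (Op m)

record Rule (m : ℕ) : Set where
  constructor rule
  field
    premises    : List (Atom m)
    conclusions : List (Atom m)
    equations   : List (Equation m)
open Rule

EquationHolds : BGraph n → (Fin m → Fin n) → Equation m → Set
EquationHolds G ρ (e₁ , e₂) = ⟦ e₁ ⟧ G ρ ≅ ⟦ e₂ ⟧ G ρ

Valid : Rule m → Set
Valid {m} R = ∀ {n} (G : BGraph n) → WF G → (ρ : Fin m → Fin n) → Injective _≡_ _≡_ ρ →
  All (Holds G ρ) (premises R) → All (Holds G ρ) (conclusions R) × All (EquationHolds G ρ) (equations R)

EquationAgrees : Mask k → (Fin k → Fin n) → BGraph n → (Fin m → Fin n) → Equation m → Set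
EquationAgrees μ σ G ρ (e₁ , e₂) = Agree μ (restrict (⟦ e₁ ⟧ G ρ) σ) (restrict (⟦ e₂ ⟧ G ρ) σ)

checkModel : Mask k → (Fin m → Fin k) → Rule m → BGraph k → Bool
checkModel μ ι R M =
  if all (holds? M ι) (premises R)
  then all (holds? M ι) (conclusions R)
       ∧ all (uncurry λ e₁ e₂ → agree? μ (⟦ e₁ ⟧ₜ M ι) (⟦ e₂ ⟧ₜ M ι)) (equations R)
  else true

checkModel-sound : ∀ (μ : Mask k) (ι : Fin m → Fin k) R M → T (checkModel μ ι R M) →
  All (Holds M ι) (premises R) → All (Holds M ι) (conclusions R) × All (EquationAgrees μ id M ι) (equations R)
checkModel-sound μ ι R M t premises-hold =
  All.map (holds?-sound M ι _) (all⁺ _ _ (proj₁ t′)) ,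
  All.map (λ {eq} → equation {eq}) (all⁺ _ _ (proj₂ t′))
  where
  t′ = Equivalence.to T-∧ (T-if t (all⁻ (holds? M ι) (All.map (holds?-complete M ι _) premises-hold)))
  equation : ∀ {eq} → T (uncurry (λ e₁ e₂ → agree? μ (⟦ e₁ ⟧ₜ M ι) (⟦ e₂ ⟧ₜ M ι)) eq) →
    EquationAgrees μ id M ι eq
  equation {e₁ , e₂} t = Agree-resp-≅ μ (⟦⟧ₜ≅⟦⟧ e₁ ≅-refl) (⟦⟧ₜ≅⟦⟧ e₂ ≅-refl) (agree?-sound μ _ _ t)

checkModel-restrict : ∀ (μ : Mask k) {σ : Fin k → Fin n} (ι : Fin m → Fin k) R {M} →
  Injective _≡_ _≡_ σ → M ≅ restrict G σ → T (checkModel μ ι R M) →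
  All (Holds G (σ ∘ ι)) (premises R) →
  All (Holds G (σ ∘ ι)) (conclusions R) × All (EquationAgrees μ σ G (σ ∘ ι)) (equations R)
checkModel-restrict {G = G} μ {σ} ι R {M} σ-inj p t premises-hold =
  let holds , agrees = checkModel-sound μ ι R M t
                         (All.map (Equivalence.from (Holds-restrict σ-inj _ p)) premises-hold)
  in All.map (Equivalence.to (Holds-restrict σ-inj _ p)) holds , All.map (λ {eq} → equation {eq}) agrees
  where
  equation : ∀ {eq} → EquationAgrees μ id M ι eq → EquationAgrees μ σ G (σ ∘ ι) eq
  equation {e₁ , e₂} = Agree-resp-≅ μ (restrict-⟦⟧ σ-inj e₁ p) (restrict-⟦⟧ σ-inj e₂ p)

-- A symmetric loopless adjacency relation, stored as its strict upper triangle.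
Triangle : ℕ → Set
Triangle zero    = ⊤
Triangle (suc k) = Vec Bool k × Triangle k

symmetricAdj : Triangle k → Fin k → Fin k → Bool
symmetricAdj {suc k} (row , t) zero    zero    = false
symmetricAdj {suc k} (row , t) zero    (suc j) = lookup row j
symmetricAdj {suc k} (row , t) (suc i) zero    = lookup row i
symmetricAdj {suc k} (row , t) (suc i) (suc j) = symmetricAdj t i j

triangle : (Fin k → Fin k → Bool) → Triangle k
triangle {zero}  a = tt
triangle {suc k} a = tabulate (a zero ∘ suc) , triangle (λ i j → a (suc i) (suc j))

symmetricAdj-triangle : (a : Fin k → Fin k → Bool) → (∀ i j → a i j ≡ a j i) → (∀ i → a i i ≡ false) →
  ∀ i j → symmetricAdj (triangle a) i j ≡ a i j
symmetricAdj-triangle {suc k} a a-sym a-irr zero    zero    = sym (a-irr zero)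
symmetricAdj-triangle {suc k} a a-sym a-irr zero    (suc j) = lookup∘tabulate _ j
symmetricAdj-triangle {suc k} a a-sym a-irr (suc i) zero    = trans (lookup∘tabulate _ i) (a-sym zero (suc i))
symmetricAdj-triangle {suc k} a a-sym a-irr (suc i) (suc j) =
  symmetricAdj-triangle (λ i j → a (suc i) (suc j)) (λ i j → a-sym (suc i) (suc j)) (λ i → a-irr (suc i)) i j

model : Triangle k → Vec Colour k → BGraph k
model t c = mkBGraph (symmetricAdj t) (lookup c)

blackModel : Triangle k → BGraph k
blackModel t = mkBGraph (symmetricAdj t) (λ _ → black)

blacken : BGraph n → BGraph n
blacken G = mkBGraph (adj G) (λ _ → black)

inducedTriangle : BGraph n → (Fin k → Fin n) → Triangle k
inducedTriangle G σ = triangle (λ i j → adj G (σ i) (σ j))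

module _ {G : BGraph n} (wf : WF G) (σ : Fin k → Fin n) where

  inducedTriangle-adj : ∀ i j → symmetricAdj (inducedTriangle G σ) i j ≡ adj G (σ i) (σ j)
  inducedTriangle-adj = symmetricAdj-triangle _ (λ i j → WF.adj-sym wf (σ i) (σ j)) (λ i → WF.adj-irr wf (σ i))

  model-restrict : model (inducedTriangle G σ) (tabulate (colour G ∘ σ)) ≅ restrict G σ
  model-restrict = mk≅ inducedTriangle-adj (lookup∘tabulate _)

  blackModel-restrict : blackModel (inducedTriangle G σ) ≅ restrict (blacken G) σ
  blackModel-restrict = mk≅ inducedTriangle-adj (λ _ → refl)

every : {A : Set} → List A → ∀ k → (Vec A k → Bool) → Bool
every xs zero    f = f []
every xs (suc k) f = all (λ x → every xs k (f ∘ (x ∷_))) xs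

every-sound : {A : Set} {xs : List A} → (∀ x → x ∈ xs) → ∀ k {f} → T (every xs k f) → ∀ v → T (f v)
every-sound xs-complete zero    t []      = t
every-sound xs-complete (suc k) t (x ∷ v) =
  every-sound xs-complete k (All.lookup (all⁺ _ _ t) (xs-complete x)) v

booleans : List Bool
booleans = true ∷ false ∷ []

booleans-complete : ∀ b → b ∈ booleans
booleans-complete true  = here refl
booleans-complete false = there (here refl)

colours : List Colour
colours = black ∷ white ∷ []

colours-complete : ∀ c → c ∈ colours
colours-complete black = here refl
colours-complete white = there (here refl)

everyTriangle : ∀ k → (Triangle k → Bool) → Bool
everyTriangle zero    f = f tt
everyTriangle (suc k) f = every booleans k λ row → everyTriangle k λ t → f (row , t)

everyTriangle-sound : ∀ k {f} → T (everyTriangle k f) → ∀ t → T (f t)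
everyTriangle-sound zero    x tt        = x
everyTriangle-sound (suc k) x (row , t) =
  everyTriangle-sound k (every-sound booleans-complete k x row) t

everyModel : ∀ k → (BGraph k → Bool) → Bool
everyModel k f = everyTriangle k λ t → every colours k λ c → f (model t c)

everyModel-sound : ∀ k {f} → T (everyModel k f) → ∀ t c → T (f (model t c))
everyModel-sound k x t = every-sound colours-complete k (everyTriangle-sound k x t)

everyBlackModel : ∀ k → (BGraph k → Bool) → Bool
everyBlackModel k f = everyTriangle k (f ∘ blackModel)

everywhere : Mask k
everywhere = record { pairs = λ _ _ → true ; vertices = λ _ → true }

isZero : Fin k → Bool
isZero zero    = true
isZero (suc _) = false

touchingZero : Mask k
touchingZero = record { pairs = λ i j → isZero i ∨ isZero j ; vertices = isZero }

pairOneZero : Mask k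
pairOneZero = record { pairs = λ { 1F 0F → true ; _ _ → false } ; vertices = λ _ → false }

adjacencyAtoms : List (Atom m) → List (Atom m)
adjacencyAtoms []                      = []
adjacencyAtoms (colourAt _ _ _ ∷ as)  = adjacencyAtoms as
adjacencyAtoms (adjAt e i j b ∷ as)   = adjAt e i j b ∷ adjacencyAtoms as

adjacencyAtoms-blacken : ∀ {ρ : Fin m → Fin n} as → All (Holds G ρ) as → All (Holds (blacken G) ρ) (adjacencyAtoms as)
adjacencyAtoms-blacken []                    []       = []
adjacencyAtoms-blacken (colourAt _ _ _ ∷ as) (_ ∷ hs) = adjacencyAtoms-blacken as hs
adjacencyAtoms-blacken {G = G} (adjAt e i j b ∷ as) (h ∷ hs) =
  trans (⟦⟧-congᵃ {G = blacken G} {G} e (λ _ _ → refl) _ _) h ∷ adjacencyAtoms-blacken as hs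

colourBlind : Rule m → Rule m
colourBlind R = rule (adjacencyAtoms (premises R)) [] (equations R)

-- A rule about m named vertices is decided on the graphs induced by the named vertices
-- together with at most two further vertices; adjacency does not depend on colours, so
-- for two further vertices all colours may be taken black.
record Verified (R : Rule m) : Set where
  field
    inside     : T (everyModel m (checkModel everywhere id R))
    oneOutside : T (everyModel (suc m) (checkModel touchingZero suc R))
    twoOutside : T (everyBlackModel (suc (suc m)) (checkModel pairOneZero (2 ↑ʳ_) (colourBlind R)))

◂-injective : {ρ : Fin m → Fin n} {a : Fin n} →
  Injective _≡_ _≡_ ρ → (∀ i → ρ i ≢ a) → Injective _≡_ _≡_ (a ◂ ρ)
◂-injective ρ-inj a∉ρ {zero}  {zero}  _ = refl
◂-injective ρ-inj a∉ρ {zero}  {suc j} e = ⊥-elim (a∉ρ j (sym e))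
◂-injective ρ-inj a∉ρ {suc i} {zero}  e = ⊥-elim (a∉ρ i e)
◂-injective ρ-inj a∉ρ {suc i} {suc j} e = cong suc (ρ-inj e)

module _ {R : Rule m} (ok : Verified R) {G : BGraph n} (wf : WF G) {ρ : Fin m → Fin n}
         (ρ-inj : Injective _≡_ _≡_ ρ) (premises-hold : All (Holds G ρ) (premises R)) where
  open Verified ok

  named-instance : All (Holds G ρ) (conclusions R) × All (EquationAgrees everywhere ρ G ρ) (equations R)
  named-instance = checkModel-restrict everywhere id R ρ-inj (model-restrict wf ρ)
    (everyModel-sound m {checkModel everywhere id R} inside (inducedTriangle G ρ) (tabulate (colour G ∘ ρ)))
    premises-hold

  one-outside-instance : ∀ a → (∀ i → ρ i ≢ a) → All (EquationAgrees touchingZero (a ◂ ρ) G ρ) (equations R)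
  one-outside-instance a a∉ρ = proj₂ (checkModel-restrict touchingZero suc R (◂-injective ρ-inj a∉ρ)
    (model-restrict wf (a ◂ ρ))
    (everyModel-sound (suc m) {checkModel touchingZero suc R} oneOutside
      (inducedTriangle G (a ◂ ρ)) (tabulate (colour G ∘ (a ◂ ρ))))
    premises-hold)

  two-outside-instance : ∀ a b → (∀ i → ρ i ≢ a) → (∀ i → (a ◂ ρ) i ≢ b) →
    All (EquationAgrees pairOneZero (b ◂ a ◂ ρ) (blacken G) ρ) (equations R)
  two-outside-instance a b a∉ρ b∉aρ = proj₂ (checkModel-restrict pairOneZero (2 ↑ʳ_) (colourBlind R)
    (◂-injective (◂-injective ρ-inj a∉ρ) b∉aρ) (blackModel-restrict wf (b ◂ a ◂ ρ))
    (everyTriangle-sound (suc (suc m)) {checkModel pairOneZero (2 ↑ʳ_) (colourBlind R) ∘ blackModel} twoOutside _)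
    (adjacencyAtoms-blacken _ premises-hold))

  equation-holds : ∀ {eq} → eq ∈ equations R → EquationHolds G ρ eq
  equation-holds {e₁ , e₂} eq∈R = mk≅ adjacent coloured
    where
    coloured : ∀ a → colour (⟦ e₁ ⟧ G ρ) a ≡ colour (⟦ e₂ ⟧ G ρ) a
    coloured a with any? (λ i → ρ i ≟ a)
    ... | yes (i , refl) = proj₂ (All.lookup (proj₂ named-instance) eq∈R) i tt
    ... | no a∉ρ = proj₂ (All.lookup (one-outside-instance a λ i e → a∉ρ (i , e)) eq∈R) zero tt

    colour-blind : ∀ e a b → adj (⟦ e ⟧ (blacken G) ρ) a b ≡ adj (⟦ e ⟧ G ρ) a b
    colour-blind e = ⟦⟧-congᵃ {G = blacken G} {G} e (λ _ _ → refl)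

    adjacent : ∀ a b → adj (⟦ e₁ ⟧ G ρ) a b ≡ adj (⟦ e₂ ⟧ G ρ) a b
    adjacent a b with any? (λ i → ρ i ≟ a) | any? (λ i → ρ i ≟ b)
    ... | yes (i , refl) | yes (j , refl) = proj₁ (All.lookup (proj₂ named-instance) eq∈R) i j tt
    ... | yes (i , refl) | no b∉ρ =
      proj₁ (All.lookup (one-outside-instance b λ j e → b∉ρ (j , e)) eq∈R) (suc i) zero tt
    ... | no a∉ρ | yes (j , refl) =
      proj₁ (All.lookup (one-outside-instance a λ i e → a∉ρ (i , e)) eq∈R) zero (suc j) tt
    ... | no a∉ρ | no b∉ρ with a ≟ b
    ...   | yes refl = proj₁ (All.lookup (one-outside-instance a λ i e → a∉ρ (i , e)) eq∈R) zero zero tt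
    ...   | no a≢b = begin
      adj (⟦ e₁ ⟧ G ρ) a b               ≡⟨ colour-blind e₁ a b ⟨
      adj (⟦ e₁ ⟧ (blacken G) ρ) a b     ≡⟨ proj₁ (All.lookup (two-outside-instance a b a∉ρ′ b∉aρ) eq∈R) 1F 0F tt ⟩
      adj (⟦ e₂ ⟧ (blacken G) ρ) a b     ≡⟨ colour-blind e₂ a b ⟩
      adj (⟦ e₂ ⟧ G ρ) a b               ∎
      where
      open ≡-Reasoning
      a∉ρ′ : ∀ i → ρ i ≢ a
      a∉ρ′ i e = a∉ρ (i , e)
      b∉aρ : ∀ i → (a ◂ ρ) i ≢ b
      b∉aρ zero    = a≢b
      b∉aρ (suc i) e = b∉ρ (i , e)

verified⇒valid : {R : Rule m} → Verified R → Valid R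
verified⇒valid ok G wf ρ ρ-inj premises-hold =
  proj₁ (named-instance ok wf ρ-inj premises-hold) , All.tabulate (equation-holds ok wf ρ-inj premises-hold)

-- Vertex 0 is the vertex u whose root graphs are compared, vertex 1 the
-- white vertex x, and vertices 1, 2 the pivot p q; in the rules with u = x or u = p, and in
-- `whiteInvolution` and `pivotLaws`, only x, resp. p q, are named.

rootOps : Root → Fin m → List (Op m)
rootOps W i = [ paint i white ]
rootOps B i = [ paint i black ]
rootOps C i = paint i white ∷ loc i ∷ paint i black ∷ []

pivotOps : Fin m → Fin m → List (Op m)
pivotOps p q = loc p ∷ loc q ∷ loc p ∷ []

reduces : Root → List (Op (suc m)) → List (Op (suc m)) → Root → Equation (suc m)
reduces r′ w s r = rootOps r′ 0F ++ w , s ++ rootOps r 0F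

whiteAtSelf : Rule 1
whiteAtSelf = rule
  [ colourAt [] 0F white ]
  [ colourAt (rootOps W 0F) 0F white ]
  ( reduces W [ loc 0F ] [ loc 0F ] W
  ∷ reduces C [] [ loc 0F ] B
  ∷ reduces B [] [ loc 0F ] C ∷ [])

whiteAway : Rule 2
whiteAway = rule
  (colourAt [] 1F white ∷ adjAt [] 0F 1F false ∷ [])
  ( colourAt (rootOps W 0F) 1F white ∷ colourAt (rootOps B 0F) 1F white
  ∷ colourAt (rootOps C 0F) 1F white ∷ [])
  ( reduces W [ loc 1F ] [ loc 1F ] W
  ∷ reduces B [ loc 1F ] [ loc 1F ] B
  ∷ reduces C [ loc 1F ] [ loc 1F ] C ∷ [])

whiteNeighbour : Rule 2
whiteNeighbour = rule
  (colourAt [] 1F white ∷ adjAt [] 0F 1F true ∷ [])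
  ( colourAt (rootOps W 0F) 1F white ∷ colourAt (rootOps B 0F) 1F white
  ∷ colourAt (rootOps C 0F) 1F black ∷ colourAt (rootOps C 0F) 0F black
  ∷ adjAt (rootOps C 0F) 1F 0F true ∷ [])
  ( reduces W [ loc 1F ] [ loc 1F ] B
  ∷ reduces B [ loc 1F ] [ loc 1F ] W
  ∷ reduces C (pivotOps 1F 0F) [ loc 1F ] C ∷ [])

whiteInvolution : Rule 1
whiteInvolution = rule
  [ colourAt [] 0F white ]
  [ colourAt [ loc 0F ] 0F white ]
  [ loc 0F ∷ loc 0F ∷ [] , [] ]

pivotPremises : Fin m → Fin m → List (Atom m)
pivotPremises p q = colourAt [] p black ∷ colourAt [] q black ∷ adjAt [] p q true ∷ []

pivotAdmissibleIn : Root → Fin (suc m) → Fin (suc m) → List (Atom (suc m))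
pivotAdmissibleIn r p q =
  colourAt (rootOps r 0F) p black ∷ colourAt (rootOps r 0F) q black ∷ adjAt (rootOps r 0F) p q true ∷ []

pivotAtSelf : Rule 2
pivotAtSelf = rule
  (pivotPremises 0F 1F)
  ( pivotAdmissibleIn B 0F 1F
  ++ colourAt (rootOps W 0F) 0F white ∷ colourAt (rootOps W 0F ++ [ loc 0F ]) 1F white
  ∷ colourAt (rootOps C 0F) 1F white ∷ colourAt (rootOps C 0F ++ [ loc 1F ]) 0F white ∷ [])
  ( reduces B (pivotOps 0F 1F) (pivotOps 0F 1F) B
  ∷ reduces W (loc 0F ∷ loc 1F ∷ []) (pivotOps 0F 1F) C
  ∷ reduces C (loc 1F ∷ loc 0F ∷ []) (pivotOps 0F 1F) W ∷ [])

pivotAway : Rule 3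
pivotAway = rule
  (pivotPremises 1F 2F ++ adjAt [] 0F 1F false ∷ adjAt [] 0F 2F false ∷ [])
  (pivotAdmissibleIn W 1F 2F ++ pivotAdmissibleIn B 1F 2F ++ pivotAdmissibleIn C 1F 2F)
  ( reduces W (pivotOps 1F 2F) (pivotOps 1F 2F) W
  ∷ reduces B (pivotOps 1F 2F) (pivotOps 1F 2F) B
  ∷ reduces C (pivotOps 1F 2F) (pivotOps 1F 2F) C ∷ [])

pivotNeighbour : Bool → Rule 3
pivotNeighbour α = rule
  (pivotPremises 1F 2F ++ adjAt [] 0F 1F α ∷ adjAt [] 0F 2F true ∷ [])
  ( pivotAdmissibleIn W 1F 2F ++ pivotAdmissibleIn B 1F 2F
  ++ colourAt (rootOps C 0F) 2F white ∷ colourAt (rootOps C 0F ++ [ loc 2F ]) 1F white ∷ [])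
  ( reduces W (pivotOps 1F 2F) (pivotOps 1F 2F) W
  ∷ reduces B (pivotOps 1F 2F) (pivotOps 1F 2F) B
  ∷ reduces C (loc 2F ∷ loc 1F ∷ []) (pivotOps 1F 2F) C ∷ [])

pivotLaws : Rule 2
pivotLaws = rule
  (pivotPremises 0F 1F)
  ( colourAt (pivotOps 0F 1F) 0F black ∷ colourAt (pivotOps 0F 1F) 1F black
  ∷ adjAt (pivotOps 0F 1F) 0F 1F true ∷ [])
  ( (pivotOps 0F 1F ++ pivotOps 0F 1F , [])
  ∷ (pivotOps 0F 1F , pivotOps 1F 0F) ∷ [])

whiteAtSelf-valid : Valid whiteAtSelf
whiteAtSelf-valid = verified⇒valid _

whiteAway-valid : Valid whiteAway
whiteAway-valid = verified⇒valid _

whiteNeighbour-valid : Valid whiteNeighbour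
whiteNeighbour-valid = verified⇒valid _

whiteInvolution-valid : Valid whiteInvolution
whiteInvolution-valid = verified⇒valid _

pivotAtSelf-valid : Valid pivotAtSelf
pivotAtSelf-valid = verified⇒valid _

pivotAway-valid : Valid pivotAway
pivotAway-valid = verified⇒valid _

pivotNeighbour-valid : ∀ α → Valid (pivotNeighbour α)
pivotNeighbour-valid true  = verified⇒valid _
pivotNeighbour-valid false = verified⇒valid _

pivotLaws-valid : Valid pivotLaws
pivotLaws-valid = verified⇒valid _

-- Criticality under white local complementations and pivots

pivot : Fin n → Fin n → List (Fin n)
pivot p q = p ∷ q ∷ p ∷ []

injective₁ : (x : Fin n) → Injective _≡_ _≡_ (x ◂ ∅)
injective₁ x = ◂-injective (λ { {()} }) λ ()

injective₂ : {u x : Fin n} → u ≢ x → Injective _≡_ _≡_ (u ◂ x ◂ ∅)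
injective₂ u≢x = ◂-injective (injective₁ _) λ { 0F → ≢-sym u≢x }

injective₃ : {u p q : Fin n} → u ≢ p → u ≢ q → p ≢ q → Injective _≡_ _≡_ (u ◂ p ◂ q ◂ ∅)
injective₃ u≢p u≢q p≢q = ◂-injective (injective₂ p≢q) λ { 0F → ≢-sym u≢p ; 1F → ≢-sym u≢q }

-- The rule instances are destructed by `case`: `with` would normalise their types, whose
-- normal forms are huge.
critical-lc-white-self : WF H → ∀ {x} → colour H x ≡ white → Critical (lc H x) x → Critical H x
critical-lc-white-self {H = H} wf {x} x-white =
  case whiteAtSelf-valid H wf (x ◂ ∅) (injective₁ x) (x-white ∷ []) of λ where
    (f ∷ [] , e₁ ∷ e₂ ∷ e₃ ∷ []) → critical-reflect λ where
      W → W , via [ x ] (w-white w-empty f) e₁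
      B → C , via [] w-empty e₂
      C → B , via [] w-empty e₃

critical-lc-white-away : WF H → ∀ {x u} → colour H x ≡ white → u ≢ x → adj H u x ≡ false →
  Critical (lc H x) u → Critical H u
critical-lc-white-away {H = H} wf {x} {u} x-white u≢x ux =
  case whiteAway-valid H wf (u ◂ x ◂ ∅) (injective₂ u≢x) (x-white ∷ ux ∷ []) of λ where
    (f₁ ∷ f₂ ∷ f₃ ∷ [] , e₁ ∷ e₂ ∷ e₃ ∷ []) → critical-reflect λ where
      W → W , via [ x ] (w-white w-empty f₁) e₁
      B → B , via [ x ] (w-white w-empty f₂) e₂
      C → C , via [ x ] (w-white w-empty f₃) e₃

critical-lc-white-neighbour : WF H → ∀ {x u} → colour H x ≡ white → u ≢ x → adj H u x ≡ true →
  Critical (lc H x) u → Critical H u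
critical-lc-white-neighbour {H = H} wf {x} {u} x-white u≢x ux =
  case whiteNeighbour-valid H wf (u ◂ x ◂ ∅) (injective₂ u≢x) (x-white ∷ ux ∷ []) of λ where
    (f₁ ∷ f₂ ∷ f₃ ∷ f₄ ∷ f₅ ∷ [] , e₁ ∷ e₂ ∷ e₃ ∷ []) → critical-reflect λ where
      W → B , via [ x ] (w-white w-empty f₂) e₂
      B → W , via [ x ] (w-white w-empty f₁) e₁
      C → C , via (pivot x u) (w-xyx w-empty f₃ f₄ f₅) e₃

critical-lc-white : WF H → ∀ {x} → colour H x ≡ white → ∀ u → Critical (lc H x) u → Critical H u
critical-lc-white {H = H} wf {x} x-white u with u ≟ x
... | yes refl = critical-lc-white-self wf x-white
... | no u≢x with adj H u x in ux
...   | false = critical-lc-white-away wf x-white u≢x ux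
...   | true  = critical-lc-white-neighbour wf x-white u≢x ux

critical-lc-white-⇔ : WF H → ∀ {x} → colour H x ≡ white → ∀ u → Critical (lc H x) u ⇔ Critical H u
critical-lc-white-⇔ {H = H} wf {x} x-white u =
  case whiteInvolution-valid H wf (x ◂ ∅) (injective₁ x) (x-white ∷ []) of λ where
    (x-white′ ∷ [] , involution ∷ []) →
      mk⇔ (critical-lc-white wf x-white u)
          (critical-lc-white (lc-WF x wf) x-white′ u ∘ critical-resp-≅ (≅-sym involution))

record BlackEdge (H : BGraph n) (p q : Fin n) : Set where
  constructor blackEdge
  field
    black₁ : colour H p ≡ black
    black₂ : colour H q ≡ black
    edge   : adj H p q ≡ true

BlackEdge-sym : WF H → ∀ {p q} → BlackEdge H p q → BlackEdge H q p
BlackEdge-sym wf {p} {q} (blackEdge cp cq pq) = blackEdge cq cp (trans (WF.adj-sym wf q p) pq)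

critical-pivot-self : WF H → ∀ {p q} → BlackEdge H p q → Critical (H ⋆ pivot p q) p → Critical H p
critical-pivot-self {H = H} wf {p} {q} (blackEdge cp cq pq) =
  case pivotAtSelf-valid H wf (p ◂ q ◂ ∅) (injective₂ (adj⇒≢ wf pq)) (cp ∷ cq ∷ pq ∷ []) of λ where
    (f₁ ∷ f₂ ∷ f₃ ∷ f₄ ∷ f₅ ∷ f₆ ∷ f₇ ∷ [] , e₁ ∷ e₂ ∷ e₃ ∷ []) → critical-reflect λ where
      W → C , via (q ∷ p ∷ []) (w-white (w-white w-empty f₆) f₇) e₃
      B → B , via (pivot p q) (w-xyx w-empty f₁ f₂ f₃) e₁
      C → W , via (p ∷ q ∷ []) (w-white (w-white w-empty f₄) f₅) e₂

critical-pivot-swap : WF H → ∀ {p q u} → BlackEdge H p q →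
  Critical (H ⋆ pivot p q) u → Critical (H ⋆ pivot q p) u
critical-pivot-swap {H = H} wf {p} {q} (blackEdge cp cq pq) =
  case pivotLaws-valid H wf (p ◂ q ◂ ∅) (injective₂ (adj⇒≢ wf pq)) (cp ∷ cq ∷ pq ∷ []) of λ where
    (_ , _ ∷ swap ∷ []) → critical-resp-≅ swap

critical-pivot-away : WF H → ∀ {p q u} → BlackEdge H p q → u ≢ p → u ≢ q →
  adj H u p ≡ false → adj H u q ≡ false → Critical (H ⋆ pivot p q) u → Critical H u
critical-pivot-away {H = H} wf {p} {q} {u} (blackEdge cp cq pq) u≢p u≢q up uq =
  case pivotAway-valid H wf (u ◂ p ◂ q ◂ ∅) (injective₃ u≢p u≢q (adj⇒≢ wf pq))
         (cp ∷ cq ∷ pq ∷ up ∷ uq ∷ []) of λ where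
    (a₁ ∷ a₂ ∷ a₃ ∷ b₁ ∷ b₂ ∷ b₃ ∷ c₁ ∷ c₂ ∷ c₃ ∷ [] , e₁ ∷ e₂ ∷ e₃ ∷ []) → critical-reflect λ where
      W → W , via (pivot p q) (w-xyx w-empty a₁ a₂ a₃) e₁
      B → B , via (pivot p q) (w-xyx w-empty b₁ b₂ b₃) e₂
      C → C , via (pivot p q) (w-xyx w-empty c₁ c₂ c₃) e₃

critical-pivot-neighbour : WF H → ∀ {p q u α} → BlackEdge H p q → u ≢ p → u ≢ q →
  adj H u p ≡ α → adj H u q ≡ true → Critical (H ⋆ pivot p q) u → Critical H u
critical-pivot-neighbour {H = H} wf {p} {q} {u} {α} (blackEdge cp cq pq) u≢p u≢q up uq =
  case pivotNeighbour-valid α H wf (u ◂ p ◂ q ◂ ∅) (injective₃ u≢p u≢q (adj⇒≢ wf pq))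
         (cp ∷ cq ∷ pq ∷ up ∷ uq ∷ []) of λ where
    (a₁ ∷ a₂ ∷ a₃ ∷ b₁ ∷ b₂ ∷ b₃ ∷ g₁ ∷ g₂ ∷ [] , e₁ ∷ e₂ ∷ e₃ ∷ []) → critical-reflect λ where
      W → W , via (pivot p q) (w-xyx w-empty a₁ a₂ a₃) e₁
      B → B , via (pivot p q) (w-xyx w-empty b₁ b₂ b₃) e₂
      C → C , via (q ∷ p ∷ []) (w-white (w-white w-empty g₁) g₂) e₃

critical-pivot : WF H → ∀ {p q} → BlackEdge H p q → ∀ u → Critical (H ⋆ pivot p q) u → Critical H u
critical-pivot {H = H} wf {p} {q} e u with u ≟ p | u ≟ q
... | yes refl | _        = critical-pivot-self wf e
... | no _     | yes refl = critical-pivot-self wf (BlackEdge-sym wf e) ∘ critical-pivot-swap wf e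
... | no u≢p   | no u≢q with adj H u p in up | adj H u q in uq
...   | α     | true  = critical-pivot-neighbour wf e u≢p u≢q up uq
...   | true  | false = critical-pivot-neighbour wf (BlackEdge-sym wf e) u≢q u≢p uq up ∘ critical-pivot-swap wf e
...   | false | false = critical-pivot-away wf e u≢p u≢q up uq

critical-pivot-⇔ : WF H → ∀ {p q} → BlackEdge H p q → ∀ u → Critical (H ⋆ pivot p q) u ⇔ Critical H u
critical-pivot-⇔ {H = H} wf {p} {q} e@(blackEdge cp cq pq) u =
  case pivotLaws-valid H wf (p ◂ q ◂ ∅) (injective₂ (adj⇒≢ wf pq)) (cp ∷ cq ∷ pq ∷ []) of λ where
    (cp′ ∷ cq′ ∷ pq′ ∷ [] , involution ∷ _ ∷ []) →
      mk⇔ (critical-pivot wf e u)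
          (critical-pivot (⋆-WF (pivot p q) wf) (blackEdge cp′ cq′ pq′) u
             ∘ critical-resp-≅ (≅-sym involution))

critical-⋆ : WF G → ∀ {s} → W° G s → ∀ u → Critical (G ⋆ s) u ⇔ Critical G u
critical-⋆ wf w-empty u = ⇔-id _
critical-⋆ {G = G} wf (w-white {s} {x} d x-white) u rewrite ⋆-++ G s [ x ] =
  critical-⋆ wf d u ⇔-∘ critical-lc-white-⇔ (⋆-WF s wf) x-white u
critical-⋆ {G = G} wf (w-xyx {s} {x} {y} d cx cy xy) u rewrite ⋆-++ G s (pivot x y) =
  critical-⋆ wf d u ⇔-∘ critical-pivot-⇔ (⋆-WF s wf) (blackEdge cx cy xy) u
critical-⋆ {G = G} wf (w-yxy {s} {x} {y} d cx cy xy) u rewrite ⋆-++ G s (pivot y x) =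
  critical-⋆ wf d u ⇔-∘ critical-pivot-⇔ (⋆-WF s wf) (BlackEdge-sym (⋆-WF s wf) (blackEdge cx cy xy)) u

proposition2p7p5 : (n : ℕ) (G : BGraph n) → WF G → Pure G →
    (s : List (Fin n)) → W° G s →
    Pure (G ⋆ s) × ((u : Fin n) → Critical (G ⋆ s) u ⇔ Critical G u)
proposition2p7p5 _ _ wf pure _ d = pure-⋆ pure d , critical-⋆ wf d
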